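{- For any node $v \in \hat{V}$ of the r-suffix trie of $T$, the set $\{ k : v \in D_k \}$ is either the integer interval $[|\mathsf{t}(v)|..\mathsf{d}(v)]$ or the empty set.
   Context: Let $T$ be a string of length $n$ over an alphabet $\Sigma$. A run of $T$ is a maximal substring $T[i..j]$ consisting of a single repeated character; a position $i$ is a run boundary if some run of $T$ starts at $i$. The r-suffix trie $\mathcal{T}$ of $T$ is the (uncompacted) trie of all suffixes $T[i..n]$ such that $i$ is a run boundary; its nodes correspond one-to-one to the prefixes of these suffixes (including the empty prefix at the root). $V$ is its node set. For a node $v$, $\mathsf{str}(v)$ is the string spelled by the path from the root to $v$, and $\mathsf{d}(v)=|\mathsf{str}(v)|$. For a character $c$ and integer $e\ge 0$, $c^e$ denotes $c$ repeated $e$ times. $\hat{V}\subseteq V$ is the set of nodes $v$ having no child $v'$ with $\mathsf{str}(v') = c^e$ for some character $c$ and integer $e\ge1$ (in particular the root is not in $\hat V$, so $\mathsf{str}(v)$ is non-empty for $v\in\hat V$). For $v \in \hat{V}$, write $\mathsf{str}(v) = c^e x$ where $e\ge1$ and $x$ is empty or begins with a character different from $c$; then $\mathsf{s}(v) = c^{e-1}$ (the string obtained by removing one character from the first run of $\mathsf{str}(v)$) and $\mathsf{t}(v) = c\,x$, so that $\mathsf{str}(v) = \mathsf{s}(v)\mathsf{t}(v)$. A node $v$ is a matching node for a non-empty string $w$ iff $\mathsf{str}(v) = w[1]^e w$ for some integer $e \ge 0$; the deepest matching node for $w$ is the matching node for $w$ of maximum depth. $D_k$ denotes the set of nodes that are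 the deepest matching node for some string of length $k$. -}

module Defs where

open import Data.Nat using (ℕ; zero; suc; _≤_)
open import Data.List using (List; []; _∷_; _++_; _∷ʳ_; drop; length; replicate; dropWhile)
open import Data.Maybe using (Maybe; just; nothing)
open import Data.Product using (Σ; ∃; _×_; _,_)
open import Data.Empty using (⊥)
open import Relation.Nullary using (¬_)
open import Relation.Binary.PropositionalEquality using (_≡_; _≢_)
open import Relation.Binary.Definitions using (DecidableEquality)

-- Strings are lists; positions are 0-indexed (paper is 1-indexed).

at : {A : Set} → List A → ℕ → Maybe A
at []       _       = nothing
at (x ∷ _)  zero    = just x
at (_ ∷ xs) (suc p) = at xs p

Run : {A : Set} → List A → ℕ → ℕ → Set
Run {A} T i j =
  Σ A λ c →
    i ≤ j
    × (∀ p → i ≤ p → p ≤ j → at T p ≡ just c)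
    × (∀ i' → i ≡ suc i' → at T i' ≢ just c)
    × (at T (suc j) ≢ just c)

RunBoundary : {A : Set} → List A → ℕ → Set
RunBoundary T i = ∃ λ j → Run T i j

-- Nodes of the r-suffix trie are identified with the strings they spell:
-- prefixes of suffixes T[i..] with i a run boundary.  str(v) = v, d(v) = length v.
Node : {A : Set} → List A → List A → Set
Node T w = ∃ λ i → RunBoundary T i × (∃ λ u → w ++ u ≡ drop i T)

-- v ∈ V̂ : a (non-root) node having no child v' with str(v') = c^e, e ≥ 1.
-- A child of v is a node spelling v ++ [a].
InVhat : {A : Set} → List A → List A → Set
InVhat {A} T v =
  v ≢ [] × Node T v ×
  ¬ (Σ A λ a → Σ A λ c → Σ ℕ λ e →
       1 ≤ e × Node T (v ∷ʳ a) × (v ∷ʳ a ≡ replicate e c))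

tStr : {A : Set} → DecidableEquality A → List A → List A
tStr _≟_ []      = []
tStr _≟_ (c ∷ w) = c ∷ dropWhile (λ x → x ≟ c) w

Matching : {A : Set} → List A → List A → List A → Set
Matching T []      v = ⊥
Matching T (c ∷ w) v = Node T v × (∃ λ e → v ≡ replicate e c ++ (c ∷ w))

Deepest : {A : Set} → List A → List A → List A → Set
Deepest T w v = Matching T w v × (∀ v' → Matching T w v' → length v' ≤ length v)

InD : {A : Set} → List A → ℕ → List A → Set
InD T k v = ∃ λ w → length w ≡ k × Deepest T w v

-- Write str(v) = c^(1+m) x with x not starting with c.  A string w is matched
-- by v only if w = c^(1+j) x with j ≤ m, and the nodes matching such a w are
-- exactly the nodes c^g x with g ≥ 1+j.  So either some node c^g x with
-- g > 1+m exists, and then it beats v for every w, or there is none, and then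
-- v is the deepest matching node of c^(1+j) x for every j ≤ m, whose lengths
-- fill the interval [|t(v)| .. d(v)] since t(v) = c x.  Which of the two
-- holds is decidable, because node-hood is a bounded search over positions.
module Submission where

open import Defs
open import Data.Nat using (ℕ; zero; suc; _+_; _∸_; _≤_; _<_; _≤?_; _<?_; z≤n; s≤s; s≤s⁻¹)
open import Data.Nat.Properties
open import Data.List using (List; []; _∷_; _++_; length; replicate; drop; dropWhile; head)
open import Data.List.Properties using (∷-injectiveˡ; ∷-injectiveʳ; length-++; length-++-≤ˡ; length-drop; length-replicate)
open import Data.Maybe using (Maybe; just; nothing)
import Data.Maybe.Properties as Maybe
open import Data.Product using (∃; _×_; _,_; proj₁)
open import Data.Sum using (_⊎_; inj₁; inj₂)
open import Data.Empty using (⊥-elim)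
open import Relation.Nullary using (¬_; Dec; yes; no; contradiction)
open import Relation.Nullary.Decidable using (map′; _×-dec_; _→-dec_; ¬?)
open import Relation.Unary using (Decidable)
open import Relation.Binary.Definitions using (DecidableEquality)
open import Relation.Binary.PropositionalEquality
open import Function using (_∘_)
open import Function.Bundles using (_⇔_; mk⇔)
open import Function.Construct.Composition using (_⇔-∘_)

∃-bounded? : {P : ℕ → Set} → Decidable P → (N : ℕ) → (∀ {n} → P n → n < N) → Dec (∃ P)
∃-bounded? P? N bound = map′ (λ (n , _ , p) → n , p) (λ (n , p) → n , bound p , p) (anyUpTo? P? N)

offset⇔range : ∀ {ℓ m k} → (∃ λ j → j ≤ m × suc j + ℓ ≡ k) ⇔ (suc ℓ ≤ k × k ≤ suc m + ℓ)
offset⇔range {ℓ} {m} {k} = mk⇔ to from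
  where
  to : (∃ λ j → j ≤ m × suc j + ℓ ≡ k) → suc ℓ ≤ k × k ≤ suc m + ℓ
  to (j , j≤m , refl) = s≤s (m≤n+m ℓ j) , +-monoˡ-≤ ℓ (s≤s j≤m)

  from : suc ℓ ≤ k × k ≤ suc m + ℓ → ∃ λ j → j ≤ m × suc j + ℓ ≡ k
  from (lo , hi) = j , s≤s⁻¹ (+-cancelʳ-≤ ℓ (suc j) (suc m) (subst (_≤ suc m + ℓ) (sym j+ℓ≡k) hi)) , j+ℓ≡k
    where
    j = k ∸ suc ℓ
    j+ℓ≡k : suc j + ℓ ≡ k
    j+ℓ≡k = trans (sym (+-suc j ℓ)) (m∸n+n≡m lo)

module _ {A : Set} where

  at-just⇒< : ∀ (T : List A) p {c} → at T p ≡ just c → p < length T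
  at-just⇒< (_ ∷ _) zero    _  = s≤s z≤n
  at-just⇒< (_ ∷ T) (suc p) eq = s≤s (at-just⇒< T p eq)

  node⇒length≤ : ∀ {T w : List A} → Node T w → length w ≤ length T
  node⇒length≤ {T} {w} (i , _ , u , eq) = begin
    length w             ≤⟨ length-++-≤ˡ w ⟩
    length (w ++ u)      ≡⟨ cong length eq ⟩
    length (drop i T)    ≡⟨ length-drop i T ⟩
    length T ∸ i         ≤⟨ m∸n≤m (length T) i ⟩
    length T             ∎
    where open ≤-Reasoning

  -- Run T i j unfolds to Σ A (RunOf T i j).
  RunOf : List A → ℕ → ℕ → A → Set
  RunOf T i j c =
    i ≤ j
    × (∀ p → i ≤ p → p ≤ j → at T p ≡ just c)
    × (∀ i' → i ≡ suc i' → at T i' ≢ just c)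
    × (at T (suc j) ≢ just c)

  runOf⇒at : ∀ {T i j c} → RunOf T i j c → at T i ≡ just c
  runOf⇒at {i = i} (i≤j , inRun , _) = inRun i ≤-refl i≤j

  runOf⇒< : ∀ {T i j c} → RunOf T i j c → j < length T
  runOf⇒< {T} {j = j} (i≤j , inRun , _) = at-just⇒< T j (inRun j i≤j ≤-refl)

  replicate-++-replicate : ∀ a b (c : A) (y : List A) →
    replicate a c ++ replicate b c ++ y ≡ replicate (a + b) c ++ y
  replicate-++-replicate zero    b c y = refl
  replicate-++-replicate (suc a) b c y = cong (c ∷_) (replicate-++-replicate a b c y)

  length-replicate-++ : ∀ n (c : A) (y : List A) → length (replicate n c ++ y) ≡ n + length y
  length-replicate-++ n c y = trans (length-++ (replicate n c)) (cong (_+ length y) (length-replicate n))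

  replicate-++-injective : ∀ {c : A} n n' {x x'} → head x ≢ just c → head x' ≢ just c →
    replicate n c ++ x ≡ replicate n' c ++ x' → n ≡ n' × x ≡ x'
  replicate-++-injective zero    zero     _  _   eq = refl , eq
  replicate-++-injective zero    (suc n') hx _   eq = contradiction (cong head eq) hx
  replicate-++-injective (suc n) zero     _  hx' eq = contradiction (cong head (sym eq)) hx'
  replicate-++-injective (suc n) (suc n') hx hx' eq =
    let n≡n' , x≡x' = replicate-++-injective n n' hx hx' (∷-injectiveʳ eq) in cong suc n≡n' , x≡x'

  head-replicate-++ : ∀ {c d : A} {y z} e → c ∷ y ≡ replicate e d ++ d ∷ z → c ≡ d
  head-replicate-++ zero    eq = ∷-injectiveˡ eq
  head-replicate-++ (suc e) eq = ∷-injectiveˡ eq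

module _ {A : Set} (_≟_ : DecidableEquality A) where

  private
    _≟ₘ_ : DecidableEquality (Maybe A)
    _≟ₘ_ = Maybe.≡-dec _≟_

  RunOf? : ∀ T i j c → Dec (RunOf T i j c)
  RunOf? T i j c = i ≤? j ×-dec inRun? ×-dec leftMaximal? i ×-dec ¬? (at T (suc j) ≟ₘ just c)
    where
    inRun? : Dec (∀ p → i ≤ p → p ≤ j → at T p ≡ just c)
    inRun? = map′ (λ all p i≤p p≤j → all (s≤s p≤j) i≤p) (λ all {p} p<1+j i≤p → all p i≤p (s≤s⁻¹ p<1+j))
      (allUpTo? (λ p → i ≤? p →-dec at T p ≟ₘ just c) (suc j))

    leftMaximal? : ∀ i → Dec (∀ i' → i ≡ suc i' → at T i' ≢ just c)
    leftMaximal? zero    = yes λ _ ()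
    leftMaximal? (suc i) = map′ (λ ne → λ { _ refl → ne }) (λ all → all i refl) (¬? (at T i ≟ₘ just c))

  Run? : ∀ T i j → Dec (Run T i j)
  Run? T i j with at T i in eq
  ... | nothing = no λ (_ , run) → contradiction (trans (sym eq) (runOf⇒at {T = T} {i} {j} run)) λ ()
  ... | just c  = map′ (c ,_) (λ (c' , run) → subst (RunOf T i j) (Maybe.just-injective (trans (sym (runOf⇒at {T = T} {i} {j} run)) eq)) run)
                       (RunOf? T i j c)

  RunBoundary? : ∀ T i → Dec (RunBoundary T i)
  RunBoundary? T i = ∃-bounded? (Run? T i) (length T) (λ (_ , run) → runOf⇒< {T = T} {i} run)

  isPrefix? : (w z : List A) → Dec (∃ λ u → w ++ u ≡ z)
  isPrefix? []      z       = yes (z , refl)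
  isPrefix? (a ∷ w) []      = no λ ()
  isPrefix? (a ∷ w) (b ∷ z) with a ≟ b
  ... | no  a≢b  = no λ (_ , eq) → a≢b (∷-injectiveˡ eq)
  ... | yes refl = map′ (λ (u , eq) → u , cong (a ∷_) eq) (λ (u , eq) → u , ∷-injectiveʳ eq) (isPrefix? w z)

  Node? : ∀ T w → Dec (Node T w)
  Node? T w = ∃-bounded? (λ i → RunBoundary? T i ×-dec isPrefix? w (drop i T)) (length T)
    (λ {i} ((j , c , run) , _) → ≤-<-trans (proj₁ run) (runOf⇒< {T = T} {i} {j} run))

  rest : A → List A → List A
  rest c = dropWhile (λ y → y ≟ c)

  replicate-++-rest : ∀ c r → ∃ λ m → r ≡ replicate m c ++ rest c r
  replicate-++-rest c []      = 0 , refl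
  replicate-++-rest c (y ∷ r) with y ≟ c
  ... | yes refl = let m , eq = replicate-++-rest c r in suc m , cong (y ∷_) eq
  ... | no  _    = 0 , refl

  head-rest : ∀ c r → head (rest c r) ≢ just c
  head-rest c []      ()
  head-rest c (y ∷ r) with y ≟ c
  ... | yes _ = head-rest c r
  ... | no y≢c = y≢c ∘ Maybe.just-injective

  module RunLine (T : List A) (c : A) (x : List A) (x-fresh : head x ≢ just c) where

    level : ℕ → List A
    level g = replicate g c ++ x

    level-+ : ∀ a b → replicate a c ++ level b ≡ level (a + b)
    level-+ a b = replicate-++-replicate a b c x

    length-level : ∀ g → length (level g) ≡ g + length x
    length-level g = length-replicate-++ g c x

    level-matching : ∀ {j g} → Node T (level g) → suc j ≤ g → Matching T (level (suc j)) (level g)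
    level-matching {j} {g} node j<g =
      node , g ∸ suc j , sym (trans (level-+ (g ∸ suc j) (suc j)) (cong level (m∸n+n≡m j<g)))

    matching-level : ∀ {j u} → Matching T (level (suc j)) u → ∃ λ g → suc j ≤ g × u ≡ level g
    matching-level {j} (_ , e , refl) = e + suc j , m≤n+m (suc j) e , level-+ e (suc j)

    level-matched : ∀ {m w} → Matching T w (level (suc m)) → ∃ λ j → j ≤ m × w ≡ level (suc j)
    level-matched {m} {d ∷ w} (_ , e , eq) with head-replicate-++ e eq
    ... | refl =
      let j , w≡ = replicate-++-rest c w
          m≡ , x≡ = replicate-++-injective (suc m) (e + suc j) x-fresh (head-rest c w)
                      (trans eq (trans (cong (λ z → replicate e c ++ c ∷ z) w≡)
                                       (replicate-++-replicate e (suc j) c (rest c w))))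
      in j , s≤s⁻¹ (≤-trans (m≤n+m (suc j) e) (≤-reflexive (sym m≡)))
           , cong (c ∷_) (trans w≡ (cong (replicate j c ++_) (sym x≡)))

    Deeper : ℕ → Set
    Deeper m = ∃ λ g → suc m < g × Node T (level g)

    Deeper? : ∀ m → Dec (Deeper m)
    Deeper? m = ∃-bounded? (λ g → suc m <? g ×-dec Node? T (level g)) (suc (length T))
      (λ {g} (_ , node) → s≤s (≤-trans (m≤m+n g (length x))
                                 (≤-trans (≤-reflexive (sym (length-level g))) (node⇒length≤ node))))

    deeper⇒¬InD : ∀ {m} → Deeper m → ∀ k → ¬ InD T k (level (suc m))
    deeper⇒¬InD {m} (g , m<g , node) k (w , _ , matched , deepest) with level-matched matched
    ... | j , j≤m , refl = <⇒≱ m<g (+-cancelʳ-≤ (length x) g (suc m)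
            (subst₂ _≤_ (length-level g) (length-level (suc m))
              (deepest (level g) (level-matching node (≤-trans (s≤s j≤m) (<⇒≤ m<g))))))

    ¬deeper⇒deepest : ∀ {m j} → Node T (level (suc m)) → ¬ Deeper m → j ≤ m →
      Deepest T (level (suc j)) (level (suc m))
    ¬deeper⇒deepest {m} node ¬deeper j≤m = level-matching node (s≤s j≤m) , maximal
      where
      maximal : ∀ u → Matching T (level (suc _)) u → length u ≤ length (level (suc m))
      maximal u matched@(node-u , _) with matching-level matched
      ... | g , _ , refl with g ≤? suc m
      ...   | yes g≤m = subst₂ _≤_ (sym (length-level g)) (sym (length-level (suc m))) (+-monoˡ-≤ (length x) g≤m)
      ...   | no  g≰m = ⊥-elim (¬deeper (g , ≰⇒> g≰m , node-u))

    InD⇔offset : ∀ {m k} → Node T (level (suc m)) → ¬ Deeper m →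
      InD T k (level (suc m)) ⇔ (∃ λ j → j ≤ m × suc j + length x ≡ k)
    InD⇔offset {m} node ¬deeper = mk⇔
      (λ { (w , refl , matched , _) → let j , j≤m , w≡ = level-matched matched
                                       in j , j≤m , sym (trans (cong length w≡) (length-level (suc j))) })
      (λ { (j , j≤m , refl) → level (suc j) , length-level (suc j) , ¬deeper⇒deepest node ¬deeper j≤m })

    InD⇔range : ∀ {m k} → Node T (level (suc m)) → ¬ Deeper m →
      InD T k (level (suc m)) ⇔ (suc (length x) ≤ k × k ≤ length (level (suc m)))
    InD⇔range {m} {k} node ¬deeper =
      subst (λ n → InD T k (level (suc m)) ⇔ (suc (length x) ≤ k × k ≤ n)) (sym (length-level (suc m)))
        (offset⇔range ⇔-∘ InD⇔offset node ¬deeper)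

lemma4 : {A : Set} (_≟_ : DecidableEquality A) (T v : List A) →
    InVhat T v →
    (∀ k → InD T k v ⇔ (length (tStr _≟_ v) ≤ k × k ≤ length v))
    ⊎ (∀ k → ¬ InD T k v)
lemma4 _≟_ T []      (v≢[] , _) = ⊥-elim (v≢[] refl)
lemma4 _≟_ T (c ∷ r) (_ , node , _) with replicate-++-rest _≟_ c r
... | m , r≡ = subst Dichotomy (sym v≡) dichotomy
  where
  x = rest _≟_ c r
  open RunLine _≟_ T c x (head-rest _≟_ c r)

  Dichotomy : List _ → Set
  Dichotomy v = (∀ k → InD T k v ⇔ (suc (length x) ≤ k × k ≤ length v)) ⊎ (∀ k → ¬ InD T k v)

  v≡ : c ∷ r ≡ level (suc m)
  v≡ = cong (c ∷_) r≡

  dichotomy : Dichotomy (level (suc m))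
  dichotomy with Deeper? m
  ... | yes deeper  = inj₂ (deeper⇒¬InD deeper)
  ... | no  ¬deeper = inj₁ λ k → InD⇔range (subst (Node T) v≡ node) ¬deeper
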